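{- Let $\mathsf{FL_{ew}}$ denote the variety of bounded commutative integral residuated lattices, and let $\mathbf 2$ be the two-element Boolean algebra (regarded as an $\mathsf{FL_{ew}}$-algebra). If $\mathbf A$ is a finite algebra that is projective in $\mathsf{FL_{ew}}$, then $\mathbf A\cong\mathbf 2$. (Moreover $\mathbf 2$ is projective in $\mathsf{FL_{ew}}$, so $\mathbf 2$ is the only finite projective algebra in $\mathsf{FL_{ew}}$.)
   Context: A commutative integral residuated lattice is an algebra $\langle A,\vee,\wedge,\cdot,\rightarrow,1\rangle$ such that $\langle A,\vee,\wedge,1\rangle$ is a lattice with greatest element $1$, $\langle A,\cdot,1\rangle$ is a commutative monoid, and $a\cdot b\le c$ iff $a\le b\rightarrow c$ for all $a,b,c$. An $\mathsf{FL_{ew}}$-algebra is such a structure with an extra constant $0$ which is the least element. An algebra $\mathbf A$ in a class $\mathcal K$ is projective in $\mathcal K$ if for all $\mathbf B,\mathbf C\in\mathcal K$, every homomorphism $h:\mathbf A\to\mathbf C$ and every surjective homomorphism $g:\mathbf B\to\mathbf C$, there is a homomorphism $f:\mathbf A\to\mathbf B$ with $h=gf$. -}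

module Defs where

open import Level using (0ℓ)
open import Data.Nat using (ℕ)
open import Data.Fin using (Fin)
open import Data.Bool using (Bool; true; false; _∧_; _∨_; not)
open import Data.Bool.Properties using (∨-∧-isLattice; ∧-isCommutativeMonoid)
open import Data.Product using (Σ; _×_; _,_)
open import Function.Bundles using (_↔_)
open import Relation.Binary.PropositionalEquality using (_≡_; refl)
import Algebra.Structures as AS
import Algebra.Lattice.Structures as LS

record FLew : Set₁ where
  infixr 6 _⊔_
  infixr 7 _⊓_
  infixr 8 _·_
  infixr 5 _⇒_
  infix 4 _≤_
  field
    Carrier : Set
    _⊔_ _⊓_ _·_ _⇒_ : Carrier → Carrier → Carrier
    𝟘 𝟙 : Carrier
    isLattice : LS.IsLattice {A = Carrier} _≡_ _⊔_ _⊓_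
    isCommutativeMonoid : AS.IsCommutativeMonoid {A = Carrier} _≡_ _·_ 𝟙

  _≤_ : Carrier → Carrier → Set
  a ≤ b = a ⊓ b ≡ a

  field
    residuated : ∀ a b c → ((a · b ≤ c) → (a ≤ b ⇒ c)) × ((a ≤ b ⇒ c) → (a · b ≤ c))
    top : ∀ a → a ≤ 𝟙
    bottom : ∀ a → 𝟘 ≤ a

open FLew public

record IsHom (A B : FLew) (f : Carrier A → Carrier B) : Set where
  field
    pres-⊔ : ∀ x y → f (_⊔_ A x y) ≡ _⊔_ B (f x) (f y)
    pres-⊓ : ∀ x y → f (_⊓_ A x y) ≡ _⊓_ B (f x) (f y)
    pres-· : ∀ x y → f (_·_ A x y) ≡ _·_ B (f x) (f y)
    pres-⇒ : ∀ x y → f (_⇒_ A x y) ≡ _⇒_ B (f x) (f y)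
    pres-𝟘 : f (𝟘 A) ≡ 𝟘 B
    pres-𝟙 : f (𝟙 A) ≡ 𝟙 B

Hom : FLew → FLew → Set
Hom A B = Σ (Carrier A → Carrier B) (IsHom A B)

Surjective : {A B : FLew} → Hom A B → Set
Surjective {A} {B} (g , _) = ∀ (c : Carrier B) → Σ (Carrier A) (λ b → g b ≡ c)

Projective : FLew → Set₁
Projective A =
  (B C : FLew) (h : Hom A C) (g : Hom B C) → Surjective {B} {C} g →
  Σ (Hom A B) (λ f → ∀ (x : Carrier A) → Σ.proj₁ h x ≡ Σ.proj₁ g (Σ.proj₁ f x))

Finite : FLew → Set
Finite A = Σ ℕ (λ n → Carrier A ↔ Fin n)

-- Isomorphism: a homomorphism with a two-sided inverse function
-- (the inverse is then automatically a homomorphism).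
_≅_ : FLew → FLew → Set
A ≅ B = Σ (Hom A B) (λ f → Σ (Carrier B → Carrier A) (λ g →
          (∀ x → g (Σ.proj₁ f x) ≡ x) × (∀ y → Σ.proj₁ f (g y) ≡ y)))

private
  _⇒𝔹_ : Bool → Bool → Bool
  a ⇒𝔹 b = not a ∨ b

  res : ∀ a b c → ((a ∧ b) ∧ c ≡ a ∧ b → a ∧ (b ⇒𝔹 c) ≡ a)
                × (a ∧ (b ⇒𝔹 c) ≡ a → (a ∧ b) ∧ c ≡ a ∧ b)
  res true true true = (λ _ → refl) , (λ _ → refl)
  res true true false = (λ ()) , (λ ())
  res true false c = (λ _ → refl) , (λ _ → refl)
  res false b c = (λ _ → refl) , (λ _ → refl)

  top𝔹 : ∀ a → a ∧ true ≡ a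
  top𝔹 true = refl
  top𝔹 false = refl

𝟚 : FLew
𝟚 = record
  { Carrier = Bool
  ; _⊔_ = _∨_ ; _⊓_ = _∧_ ; _·_ = _∧_ ; _⇒_ = _⇒𝔹_
  ; 𝟘 = false ; 𝟙 = true
  ; isLattice = ∨-∧-isLattice
  ; isCommutativeMonoid = ∧-isCommutativeMonoid
  ; residuated = res
  ; top = top𝔹
  ; bottom = λ _ → refl
  }

-- 𝟚 is projective because it is initial. Conversely, let A be finite and
-- projective. Build the algebra A⁺ whose elements are a new top ⊤⁺ and pairs
-- ⟨ x , d ⟩ of an element of A and a depth d ∈ ℕ ∪ {∞}, ordered by x and by
-- reverse depth, where depths add with an extra +1 under multiplication.
-- Forgetting the depth is a surjection π : A⁺ → A, so projectivity yields a
-- section σ. An element x ≠ 𝟙 cannot have finite depth under σ, since then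
-- the powers of x would have strictly increasing depths and hence be pairwise
-- distinct in the finite algebra A. So σ x = ⟨ x , ∞ ⟩, and computing
-- σ (x ⇒ 𝟘) in A⁺ forces x ⇒ 𝟘 = 𝟙, i.e. x = 𝟘. Thus A = {𝟘, 𝟙}.
module Submission where

open import Defs using (FLew; Carrier; IsHom; Hom; Surjective; Projective; Finite; _≅_; 𝟚)
open import Data.Bool using (Bool; true; false)
open import Data.Empty using (⊥-elim)
import Data.Fin as Fin
import Data.Fin.Properties as Fin
open import Data.Nat using (ℕ; zero; suc; _+_; _*_; _∸_; z≤n)
  renaming (_≤_ to _≤ℕ_; _≤?_ to _≤ℕ?_; _⊓_ to _⊓ℕ_; _⊔_ to _⊔ℕ_)
import Data.Nat.Properties as ℕ
open import Data.Product using (Σ; _×_; _,_; proj₁; proj₂)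
open import Data.Sum using (_⊎_; inj₁; inj₂)
open import Function.Base using (id)
open import Function.Bundles using (Injection)
open import Function.Definitions using (Injective)
open import Function.Properties.Inverse using (↔⇒↣)
open import Relation.Binary.Definitions using (DecidableEquality; Decidable)
open import Relation.Binary.PropositionalEquality
open import Relation.Nullary using (¬_; yes; no)
open import Relation.Nullary.Decidable using (_×-dec_; map′; via-injection)
import Algebra.Structures as AS
import Algebra.Lattice.Structures as LS
import Algebra.Lattice.Properties.Lattice as LatticeProperties
open import Algebra.Lattice.Bundles using (Lattice)
open import Level using (0ℓ)

module FLewProperties (X : FLew) where
  open FLew X public hiding (Carrier)
  open LS.IsLattice isLattice using (∨-comm; ∧-comm; ∨-absorbs-∧)
  open AS.IsCommutativeMonoid isCommutativeMonoid using (identityˡ; identityʳ)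

  lattice : Lattice 0ℓ 0ℓ
  lattice = record { isLattice = isLattice }

  open LatticeProperties lattice public using (∧-idem; ∨-idem)

  ≤-antisym : ∀ {x y} → x ≤ y → y ≤ x → x ≡ y
  ≤-antisym {x} {y} x≤y y≤x = trans (sym x≤y) (trans (∧-comm x y) y≤x)

  ⊓-identityˡ : ∀ x → 𝟙 ⊓ x ≡ x
  ⊓-identityˡ x = trans (∧-comm 𝟙 x) (top x)

  ⊔-zeroˡ : ∀ x → 𝟙 ⊔ x ≡ 𝟙
  ⊔-zeroˡ x = trans (cong (𝟙 ⊔_) (sym (⊓-identityˡ x))) (∨-absorbs-∧ 𝟙 x)

  ⊔-zeroʳ : ∀ x → x ⊔ 𝟙 ≡ 𝟙
  ⊔-zeroʳ x = trans (∨-comm x 𝟙) (⊔-zeroˡ x)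

  ⊔-identityˡ : ∀ x → 𝟘 ⊔ x ≡ x
  ⊔-identityˡ x = begin
    𝟘 ⊔ x        ≡⟨ ∨-comm 𝟘 x ⟩
    x ⊔ 𝟘        ≡⟨ cong (x ⊔_) (sym (trans (∧-comm x 𝟘) (bottom x))) ⟩
    x ⊔ (x ⊓ 𝟘)  ≡⟨ ∨-absorbs-∧ x 𝟘 ⟩
    x            ∎
    where open ≡-Reasoning

  ·-zeroˡ : ∀ x → 𝟘 · x ≡ 𝟘
  ·-zeroˡ x = ≤-antisym (proj₂ (residuated 𝟘 x 𝟘) (bottom _)) (bottom _)

  ≤→⇒≡𝟙 : ∀ {x y} → x ≤ y → x ⇒ y ≡ 𝟙
  ≤→⇒≡𝟙 {x} {y} x≤y =
    trans (sym (⊓-identityˡ _)) (proj₁ (residuated 𝟙 x y) (subst (_≤ y) (sym (identityˡ x)) x≤y))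

  ⇒≡𝟙→·≤ : ∀ {x y z} → y ⇒ z ≡ 𝟙 → x · y ≤ z
  ⇒≡𝟙→·≤ {x} {y} {z} y⇒z≡𝟙 = proj₂ (residuated x y z) (trans (cong (x ⊓_) y⇒z≡𝟙) (top x))

  ⇒≡𝟙→≤ : ∀ {x y} → x ⇒ y ≡ 𝟙 → x ≤ y
  ⇒≡𝟙→≤ {x} x⇒y≡𝟙 = subst (_≤ _) (identityˡ x) (⇒≡𝟙→·≤ x⇒y≡𝟙)

  ⇒-zeroʳ : ∀ x → x ⇒ 𝟙 ≡ 𝟙
  ⇒-zeroʳ x = ≤→⇒≡𝟙 (top x)

  𝟘⇒-≡𝟙 : ∀ x → 𝟘 ⇒ x ≡ 𝟙
  𝟘⇒-≡𝟙 x = ≤→⇒≡𝟙 (bottom x)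

  ⇒-identityˡ : ∀ x → 𝟙 ⇒ x ≡ x
  ⇒-identityˡ x = ≤-antisym
    (subst (_≤ x) (identityʳ _) (proj₂ (residuated (𝟙 ⇒ x) 𝟙 x) (∧-idem _)))
    (proj₁ (residuated x 𝟙 x) (subst (_≤ x) (sym (identityʳ x)) (∧-idem x)))

  ⇒𝟘≡𝟙→≡𝟘 : ∀ {x} → x ⇒ 𝟘 ≡ 𝟙 → x ≡ 𝟘
  ⇒𝟘≡𝟙→≡𝟘 x⇒𝟘≡𝟙 = ≤-antisym (⇒≡𝟙→≤ x⇒𝟘≡𝟙) (bottom _)

  infixr 9 _^_
  _^_ : Carrier X → ℕ → Carrier X
  x ^ zero = 𝟙
  x ^ suc k = x · x ^ k

  fromBool : Bool → Carrier X
  fromBool false = 𝟘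
  fromBool true = 𝟙

  fromBool-isHom : IsHom 𝟚 X fromBool
  fromBool-isHom = record
    { pres-⊔ = λ { false y → sym (⊔-identityˡ (fromBool y)) ; true y → sym (⊔-zeroˡ (fromBool y)) }
    ; pres-⊓ = λ { false y → sym (bottom (fromBool y)) ; true y → sym (⊓-identityˡ (fromBool y)) }
    ; pres-· = λ { false y → sym (·-zeroˡ (fromBool y)) ; true y → sym (identityˡ (fromBool y)) }
    ; pres-⇒ = λ { false y → sym (𝟘⇒-≡𝟙 (fromBool y)) ; true y → sym (⇒-identityˡ (fromBool y)) }
    ; pres-𝟘 = refl
    ; pres-𝟙 = refl
    }

open FLewProperties using (fromBool; fromBool-isHom)

module _ {A B : FLew} where
  private
    module A = FLewProperties A
    module B = FLewProperties B

  ^-homo : ∀ {f} → IsHom A B f → ∀ x k → f (x A.^ k) ≡ f x B.^ k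
  ^-homo f-hom x zero = IsHom.pres-𝟙 f-hom
  ^-homo {f} f-hom x (suc k) = trans (IsHom.pres-· f-hom x _) (cong (f x B.·_) (^-homo f-hom x k))

  IsHom-inverse : ∀ {f g} → IsHom A B f →
                  (∀ x → g (f x) ≡ x) → (∀ y → f (g y) ≡ y) → IsHom B A g
  IsHom-inverse {f} {g} f-hom g∘f≗id f∘g≗id = record
    { pres-⊔ = transport A._⊔_ B._⊔_ (IsHom.pres-⊔ f-hom)
    ; pres-⊓ = transport A._⊓_ B._⊓_ (IsHom.pres-⊓ f-hom)
    ; pres-· = transport A._·_ B._·_ (IsHom.pres-· f-hom)
    ; pres-⇒ = transport A._⇒_ B._⇒_ (IsHom.pres-⇒ f-hom)
    ; pres-𝟘 = trans (cong g (sym (IsHom.pres-𝟘 f-hom))) (g∘f≗id A.𝟘)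
    ; pres-𝟙 = trans (cong g (sym (IsHom.pres-𝟙 f-hom))) (g∘f≗id A.𝟙)
    }
    where
    open ≡-Reasoning
    transport : ∀ (_∙_ : _) (_∘_ : _) → (∀ x y → f (x ∙ y) ≡ f x ∘ f y) →
                ∀ u v → g (u ∘ v) ≡ g u ∙ g v
    transport _∙_ _∘_ pres u v = begin
      g (u ∘ v)                 ≡⟨ cong g (sym (cong₂ _∘_ (f∘g≗id u) (f∘g≗id v))) ⟩
      g (f (g u) ∘ f (g v))     ≡⟨ cong g (sym (pres (g u) (g v))) ⟩
      g (f (g u ∙ g v))         ≡⟨ g∘f≗id (g u ∙ g v) ⟩
      g u ∙ g v                 ∎

id-isHom : (A : FLew) → IsHom A A id
id-isHom A = record
  { pres-⊔ = λ _ _ → refl ; pres-⊓ = λ _ _ → refl ; pres-· = λ _ _ → refl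
  ; pres-⇒ = λ _ _ → refl ; pres-𝟘 = refl ; pres-𝟙 = refl }

𝟚-projective : Projective 𝟚
𝟚-projective B C (h , h-hom) (g , g-hom) _ = (fromBool B , fromBool-isHom B) , agree
  where
  agree : ∀ b → h b ≡ g (fromBool B b)
  agree false = trans (IsHom.pres-𝟘 h-hom) (sym (IsHom.pres-𝟘 g-hom))
  agree true = trans (IsHom.pres-𝟙 h-hom) (sym (IsHom.pres-𝟙 g-hom))

module _ (X : FLew) where
  open FLew X hiding (Carrier)

  two-valued⇒≅𝟚 : 𝟘 ≢ 𝟙 → (∀ x → x ≡ 𝟘 ⊎ x ≡ 𝟙) → X ≅ 𝟚
  two-valued⇒≅𝟚 𝟘≢𝟙 two-valued =
    (toBool , IsHom-inverse (fromBool-isHom X) toBool∘fromBool fromBool∘toBool) ,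
    fromBool X , fromBool∘toBool , toBool∘fromBool
    where
    toBool : Carrier X → Bool
    toBool x with two-valued x
    ... | inj₁ _ = false
    ... | inj₂ _ = true

    fromBool∘toBool : ∀ x → fromBool X (toBool x) ≡ x
    fromBool∘toBool x with two-valued x
    ... | inj₁ x≡𝟘 = sym x≡𝟘
    ... | inj₂ x≡𝟙 = sym x≡𝟙

    toBool∘fromBool : ∀ b → toBool (fromBool X b) ≡ b
    toBool∘fromBool false with two-valued 𝟘
    ... | inj₁ _ = refl
    ... | inj₂ 𝟘≡𝟙 = ⊥-elim (𝟘≢𝟙 𝟘≡𝟙)
    toBool∘fromBool true with two-valued 𝟙
    ... | inj₁ 𝟙≡𝟘 = ⊥-elim (𝟘≢𝟙 (sym 𝟙≡𝟘))
    ... | inj₂ _ = refl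

ℕ↛Fin : ∀ n (s : ℕ → Fin.Fin n) → ¬ Injective _≡_ _≡_ s
ℕ↛Fin n s s-injective
  with i , j , i<j , sᵢ≡sⱼ ← Fin.pigeonhole (ℕ.n<1+n n) (λ k → s (Fin.toℕ k))
  = ℕ.<⇒≢ i<j (s-injective sᵢ≡sⱼ)

module _ (A : FLew) where
  finite⇒decidableEquality : Finite A → DecidableEquality (Carrier A)
  finite⇒decidableEquality (_ , A↔Fin) = via-injection (↔⇒↣ A↔Fin) Fin._≟_

  finite⇒¬ℕ↣ : Finite A → (s : ℕ → Carrier A) → ¬ Injective _≡_ _≡_ s
  finite⇒¬ℕ↣ (n , A↔Fin) s s-injective = ℕ↛Fin n (λ k → to (s k)) (λ eq → s-injective (injective eq))
    where open Injection (↔⇒↣ A↔Fin) using (to; injective)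

data ℕ∞ : Set where
  fin : ℕ → ℕ∞
  ∞   : ℕ∞

fin-injective : ∀ {m n} → fin m ≡ fin n → m ≡ n
fin-injective refl = refl

infix 4 _≤∞_ _≤∞?_
data _≤∞_ : ℕ∞ → ℕ∞ → Set where
  fin≤fin : ∀ {m n} → m ≤ℕ n → fin m ≤∞ fin n
  ≤∞-top  : ∀ {d} → d ≤∞ ∞

_≤∞?_ : Decidable _≤∞_
fin m ≤∞? fin n = map′ fin≤fin (λ { (fin≤fin m≤n) → m≤n }) (m ≤ℕ? n)
fin m ≤∞? ∞ = yes ≤∞-top
∞ ≤∞? fin n = no λ ()
∞ ≤∞? ∞ = yes ≤∞-top

min max _⊕_ _⊖_ : ℕ∞ → ℕ∞ → ℕ∞
min (fin m) (fin n) = fin (m ⊓ℕ n)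
min (fin m) ∞ = fin m
min ∞ e = e

max (fin m) (fin n) = fin (m ⊔ℕ n)
max (fin m) ∞ = ∞
max ∞ e = ∞

-- The extra suc makes the depths of powers strictly increase; with plain +
-- the projection onto the three-element Gödel chain would split.
fin m ⊕ fin n = fin (suc (m + n))
fin m ⊕ ∞ = ∞
∞ ⊕ e = ∞

-- d ⊖ e is the least f with d ≤∞ e ⊕ f.
d ⊖ ∞ = fin 0
fin m ⊖ fin n = fin (m ∸ suc n)
∞ ⊖ fin n = ∞

min-comm : ∀ d e → min d e ≡ min e d
min-comm (fin m) (fin n) = cong fin (ℕ.⊓-comm m n)
min-comm (fin m) ∞ = refl
min-comm ∞ (fin n) = refl
min-comm ∞ ∞ = refl

max-comm : ∀ d e → max d e ≡ max e d
max-comm (fin m) (fin n) = cong fin (ℕ.⊔-comm m n)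
max-comm (fin m) ∞ = refl
max-comm ∞ (fin n) = refl
max-comm ∞ ∞ = refl

⊕-comm : ∀ d e → d ⊕ e ≡ e ⊕ d
⊕-comm (fin m) (fin n) = cong (λ k → fin (suc k)) (ℕ.+-comm m n)
⊕-comm (fin m) ∞ = refl
⊕-comm ∞ (fin n) = refl
⊕-comm ∞ ∞ = refl

min-assoc : ∀ d e f → min (min d e) f ≡ min d (min e f)
min-assoc (fin l) (fin m) (fin n) = cong fin (ℕ.⊓-assoc l m n)
min-assoc (fin l) (fin m) ∞ = refl
min-assoc (fin l) ∞ f = refl
min-assoc ∞ e f = refl

max-assoc : ∀ d e f → max (max d e) f ≡ max d (max e f)
max-assoc (fin l) (fin m) (fin n) = cong fin (ℕ.⊔-assoc l m n)
max-assoc (fin l) (fin m) ∞ = refl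
max-assoc (fin l) ∞ f = refl
max-assoc ∞ e f = refl

⊕-assoc : ∀ d e f → (d ⊕ e) ⊕ f ≡ d ⊕ (e ⊕ f)
⊕-assoc (fin l) (fin m) (fin n) =
  cong (λ k → fin (suc k)) (trans (cong suc (ℕ.+-assoc l m n)) (sym (ℕ.+-suc l (m + n))))
⊕-assoc (fin l) (fin m) ∞ = refl
⊕-assoc (fin l) ∞ f = refl
⊕-assoc ∞ e f = refl

min-idem : ∀ d → min d d ≡ d
min-idem (fin m) = cong fin (ℕ.⊓-idem m)
min-idem ∞ = refl

min-absorbs-max : ∀ d e → min d (max d e) ≡ d
min-absorbs-max (fin m) (fin n) = cong fin (ℕ.⊓-absorbs-⊔ m n)
min-absorbs-max (fin m) ∞ = refl
min-absorbs-max ∞ e = refl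

max-absorbs-min : ∀ d e → max d (min d e) ≡ d
max-absorbs-min (fin m) (fin n) = cong fin (ℕ.⊔-absorbs-⊓ m n)
max-absorbs-min (fin m) ∞ = cong fin (ℕ.⊔-idem m)
max-absorbs-min ∞ e = refl

max≡ˡ⇒≥ : ∀ d e → max d e ≡ d → e ≤∞ d
max≡ˡ⇒≥ (fin m) (fin n) eq = fin≤fin (ℕ.≤-trans (ℕ.m≤n⊔m m n) (ℕ.≤-reflexive (fin-injective eq)))
max≡ˡ⇒≥ ∞ e eq = ≤∞-top

≥⇒max≡ˡ : ∀ {d e} → e ≤∞ d → max d e ≡ d
≥⇒max≡ˡ (fin≤fin n≤m) = cong fin (ℕ.m≥n⇒m⊔n≡m n≤m)
≥⇒max≡ˡ {∞} ≤∞-top = refl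

≤∞-⊕ˡ : ∀ d {e f} → f ≤∞ e → f ≤∞ d ⊕ e
≤∞-⊕ˡ (fin l) (fin≤fin {n = m} n≤m) = fin≤fin (ℕ.m≤n⇒m≤1+n (ℕ.m≤n⇒m≤o+n l n≤m))
≤∞-⊕ˡ (fin l) ≤∞-top = ≤∞-top
≤∞-⊕ˡ ∞ _ = ≤∞-top

⊖≤⇒≤⊕ : ∀ d e f → d ⊖ e ≤∞ f → d ≤∞ e ⊕ f
⊖≤⇒≤⊕ (fin n) (fin m) (fin l) (fin≤fin n∸m≤l) =
  fin≤fin (ℕ.≤-trans (ℕ.m≤n+m∸n n (suc m)) (ℕ.+-monoʳ-≤ (suc m) n∸m≤l))
⊖≤⇒≤⊕ d (fin m) ∞ _ = ≤∞-top
⊖≤⇒≤⊕ d ∞ f _ = ≤∞-top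

≤⊕⇒⊖≤ : ∀ d e f → d ≤∞ e ⊕ f → d ⊖ e ≤∞ f
≤⊕⇒⊖≤ (fin n) (fin m) (fin l) (fin≤fin n≤m⊕l) = fin≤fin (ℕ.m≤n+o⇒m∸n≤o n (suc m) n≤m⊕l)
≤⊕⇒⊖≤ d (fin m) ∞ _ = ≤∞-top
≤⊕⇒⊖≤ d ∞ (fin l) _ = fin≤fin z≤n
≤⊕⇒⊖≤ d ∞ ∞ _ = ≤∞-top

module Cover (A : FLew) (_≟_ : DecidableEquality (Carrier A)) where
  open FLewProperties A hiding (fromBool; fromBool-isHom)
  open LS.IsLattice isLattice using (∨-comm; ∨-assoc; ∧-comm; ∧-assoc; ∨-absorbs-∧; ∧-absorbs-∨)
  open AS.IsCommutativeMonoid isCommutativeMonoid using (identityˡ; identityʳ)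
    renaming (comm to ·-comm; assoc to ·-assoc)

  data C⁺ : Set where
    ⊤⁺    : C⁺
    ⟨_,_⟩ : Carrier A → ℕ∞ → C⁺

  ⟨⟩-injectiveʳ : ∀ {x y d e} → ⟨ x , d ⟩ ≡ ⟨ y , e ⟩ → d ≡ e
  ⟨⟩-injectiveʳ refl = refl

  π : C⁺ → Carrier A
  π ⊤⁺ = 𝟙
  π ⟨ x , d ⟩ = x

  infixr 5 _⇒⁺_
  infixr 6 _⊔⁺_
  infixr 7 _⊓⁺_
  infixr 8 _·⁺_
  infix 4 _≤⁺_

  _⊔⁺_ _⊓⁺_ _·⁺_ _⇒⁺_ : C⁺ → C⁺ → C⁺
  ⊤⁺ ⊔⁺ b = ⊤⁺
  ⟨ x , d ⟩ ⊔⁺ ⊤⁺ = ⊤⁺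
  ⟨ x , d ⟩ ⊔⁺ ⟨ y , e ⟩ = ⟨ x ⊔ y , min d e ⟩

  ⊤⁺ ⊓⁺ b = b
  ⟨ x , d ⟩ ⊓⁺ ⊤⁺ = ⟨ x , d ⟩
  ⟨ x , d ⟩ ⊓⁺ ⟨ y , e ⟩ = ⟨ x ⊓ y , max d e ⟩

  ⊤⁺ ·⁺ b = b
  ⟨ x , d ⟩ ·⁺ ⊤⁺ = ⟨ x , d ⟩
  ⟨ x , d ⟩ ·⁺ ⟨ y , e ⟩ = ⟨ x · y , d ⊕ e ⟩

  ⊤⁺ ⇒⁺ c = c
  ⟨ x , d ⟩ ⇒⁺ ⊤⁺ = ⊤⁺
  -- The test is exactly ⟨ x , d ⟩ ≤⁺ ⟨ y , e ⟩.
  ⟨ x , d ⟩ ⇒⁺ ⟨ y , e ⟩ with e ≤∞? d ×-dec (x ⇒ y) ≟ 𝟙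
  ... | yes _ = ⊤⁺
  ... | no _ = ⟨ x ⇒ y , e ⊖ d ⟩

  _≤⁺_ : C⁺ → C⁺ → Set
  a ≤⁺ b = a ⊓⁺ b ≡ a

  ⟨⟩-≤⁺ : ∀ {x y d e} → x ≤ y → e ≤∞ d → ⟨ x , d ⟩ ≤⁺ ⟨ y , e ⟩
  ⟨⟩-≤⁺ x≤y e≤d = cong₂ ⟨_,_⟩ x≤y (≥⇒max≡ˡ e≤d)

  ⟨⟩-≤⁺⁻¹ : ∀ {x y d e} → ⟨ x , d ⟩ ≤⁺ ⟨ y , e ⟩ → x ≤ y × e ≤∞ d
  ⟨⟩-≤⁺⁻¹ {d = d} {e} eq = cong π eq , max≡ˡ⇒≥ d e (⟨⟩-injectiveʳ eq)

  ⊔⁺-comm : ∀ a b → a ⊔⁺ b ≡ b ⊔⁺ a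
  ⊔⁺-comm ⊤⁺ ⊤⁺ = refl
  ⊔⁺-comm ⊤⁺ ⟨ y , e ⟩ = refl
  ⊔⁺-comm ⟨ x , d ⟩ ⊤⁺ = refl
  ⊔⁺-comm ⟨ x , d ⟩ ⟨ y , e ⟩ = cong₂ ⟨_,_⟩ (∨-comm x y) (min-comm d e)

  ⊓⁺-comm : ∀ a b → a ⊓⁺ b ≡ b ⊓⁺ a
  ⊓⁺-comm ⊤⁺ ⊤⁺ = refl
  ⊓⁺-comm ⊤⁺ ⟨ y , e ⟩ = refl
  ⊓⁺-comm ⟨ x , d ⟩ ⊤⁺ = refl
  ⊓⁺-comm ⟨ x , d ⟩ ⟨ y , e ⟩ = cong₂ ⟨_,_⟩ (∧-comm x y) (max-comm d e)

  ·⁺-comm : ∀ a b → a ·⁺ b ≡ b ·⁺ a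
  ·⁺-comm ⊤⁺ ⊤⁺ = refl
  ·⁺-comm ⊤⁺ ⟨ y , e ⟩ = refl
  ·⁺-comm ⟨ x , d ⟩ ⊤⁺ = refl
  ·⁺-comm ⟨ x , d ⟩ ⟨ y , e ⟩ = cong₂ ⟨_,_⟩ (·-comm x y) (⊕-comm d e)

  ⊔⁺-assoc : ∀ a b c → (a ⊔⁺ b) ⊔⁺ c ≡ a ⊔⁺ (b ⊔⁺ c)
  ⊔⁺-assoc ⊤⁺ b c = refl
  ⊔⁺-assoc ⟨ x , d ⟩ ⊤⁺ c = refl
  ⊔⁺-assoc ⟨ x , d ⟩ ⟨ y , e ⟩ ⊤⁺ = refl
  ⊔⁺-assoc ⟨ x , d ⟩ ⟨ y , e ⟩ ⟨ z , f ⟩ = cong₂ ⟨_,_⟩ (∨-assoc x y z) (min-assoc d e f)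

  ⊓⁺-assoc : ∀ a b c → (a ⊓⁺ b) ⊓⁺ c ≡ a ⊓⁺ (b ⊓⁺ c)
  ⊓⁺-assoc ⊤⁺ b c = refl
  ⊓⁺-assoc ⟨ x , d ⟩ ⊤⁺ c = refl
  ⊓⁺-assoc ⟨ x , d ⟩ ⟨ y , e ⟩ ⊤⁺ = refl
  ⊓⁺-assoc ⟨ x , d ⟩ ⟨ y , e ⟩ ⟨ z , f ⟩ = cong₂ ⟨_,_⟩ (∧-assoc x y z) (max-assoc d e f)

  ·⁺-assoc : ∀ a b c → (a ·⁺ b) ·⁺ c ≡ a ·⁺ (b ·⁺ c)
  ·⁺-assoc ⊤⁺ b c = refl
  ·⁺-assoc ⟨ x , d ⟩ ⊤⁺ c = refl
  ·⁺-assoc ⟨ x , d ⟩ ⟨ y , e ⟩ ⊤⁺ = refl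
  ·⁺-assoc ⟨ x , d ⟩ ⟨ y , e ⟩ ⟨ z , f ⟩ = cong₂ ⟨_,_⟩ (·-assoc x y z) (⊕-assoc d e f)

  ⊔⁺-absorbs-⊓⁺ : ∀ a b → a ⊔⁺ (a ⊓⁺ b) ≡ a
  ⊔⁺-absorbs-⊓⁺ ⊤⁺ b = refl
  ⊔⁺-absorbs-⊓⁺ ⟨ x , d ⟩ ⊤⁺ = cong₂ ⟨_,_⟩ (∨-idem x) (min-idem d)
  ⊔⁺-absorbs-⊓⁺ ⟨ x , d ⟩ ⟨ y , e ⟩ = cong₂ ⟨_,_⟩ (∨-absorbs-∧ x y) (min-absorbs-max d e)

  ⊓⁺-absorbs-⊔⁺ : ∀ a b → a ⊓⁺ (a ⊔⁺ b) ≡ a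
  ⊓⁺-absorbs-⊔⁺ ⊤⁺ b = refl
  ⊓⁺-absorbs-⊔⁺ ⟨ x , d ⟩ ⊤⁺ = refl
  ⊓⁺-absorbs-⊔⁺ ⟨ x , d ⟩ ⟨ y , e ⟩ = cong₂ ⟨_,_⟩ (∧-absorbs-∨ x y) (max-absorbs-min d e)

  ·⁺-identityʳ : ∀ a → a ·⁺ ⊤⁺ ≡ a
  ·⁺-identityʳ ⊤⁺ = refl
  ·⁺-identityʳ ⟨ x , d ⟩ = refl

  ≤⁺-top : ∀ a → a ≤⁺ ⊤⁺
  ≤⁺-top ⊤⁺ = refl
  ≤⁺-top ⟨ x , d ⟩ = refl

  residuated⁺ : ∀ a b c → (a ·⁺ b ≤⁺ c → a ≤⁺ b ⇒⁺ c) × (a ≤⁺ b ⇒⁺ c → a ·⁺ b ≤⁺ c)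
  residuated⁺ a ⊤⁺ c rewrite ·⁺-identityʳ a = id , id
  residuated⁺ a ⟨ y , e ⟩ ⊤⁺ = (λ _ → ≤⁺-top a) , (λ _ → ≤⁺-top (a ·⁺ ⟨ y , e ⟩))
  residuated⁺ ⊤⁺ ⟨ y , e ⟩ ⟨ z , f ⟩ with f ≤∞? e ×-dec (y ⇒ z) ≟ 𝟙
  ... | yes (f≤e , y⇒z≡𝟙) = (λ _ → refl) , (λ _ → ⟨⟩-≤⁺ (⇒≡𝟙→≤ y⇒z≡𝟙) f≤e)
  ... | no ¬f≤e×y⇒z≡𝟙 = (λ b≤c → let y≤z , f≤e = ⟨⟩-≤⁺⁻¹ b≤c in
                                  ⊥-elim (¬f≤e×y⇒z≡𝟙 (f≤e , ≤→⇒≡𝟙 y≤z)))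
                      , λ ()
  residuated⁺ ⟨ x , d ⟩ ⟨ y , e ⟩ ⟨ z , f ⟩ with f ≤∞? e ×-dec (y ⇒ z) ≟ 𝟙
  ... | yes (f≤e , y⇒z≡𝟙) = (λ _ → refl) , (λ _ → ⟨⟩-≤⁺ (⇒≡𝟙→·≤ y⇒z≡𝟙) (≤∞-⊕ˡ d f≤e))
  ... | no _ =
    (λ ab≤c → let xy≤z , f≤de = ⟨⟩-≤⁺⁻¹ ab≤c in
      ⟨⟩-≤⁺ (proj₁ (residuated x y z) xy≤z) (≤⊕⇒⊖≤ f e d (subst (f ≤∞_) (⊕-comm d e) f≤de))) ,
    (λ a≤b⇒c → let x≤y⇒z , f⊖e≤d = ⟨⟩-≤⁺⁻¹ a≤b⇒c in
      ⟨⟩-≤⁺ (proj₂ (residuated x y z) x≤y⇒z) (subst (f ≤∞_) (⊕-comm e d) (⊖≤⇒≤⊕ f e d f⊖e≤d)))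

  ⇒⁺-componentwise : ∀ x y d e → x ⇒ y ≡ 𝟙 ⊎ ⟨ x , d ⟩ ⇒⁺ ⟨ y , e ⟩ ≡ ⟨ x ⇒ y , e ⊖ d ⟩
  ⇒⁺-componentwise x y d e with e ≤∞? d ×-dec (x ⇒ y) ≟ 𝟙
  ... | yes (_ , x⇒y≡𝟙) = inj₁ x⇒y≡𝟙
  ... | no _ = inj₂ refl

  𝟘⁺ : C⁺
  𝟘⁺ = ⟨ 𝟘 , ∞ ⟩

  𝟘⁺-≤⁺ : ∀ a → 𝟘⁺ ≤⁺ a
  𝟘⁺-≤⁺ ⊤⁺ = refl
  𝟘⁺-≤⁺ ⟨ y , e ⟩ = cong (λ z → ⟨ z , ∞ ⟩) (bottom y)

  A⁺ : FLew
  A⁺ = record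
    { Carrier = C⁺
    ; _⊔_ = _⊔⁺_ ; _⊓_ = _⊓⁺_ ; _·_ = _·⁺_ ; _⇒_ = _⇒⁺_
    ; 𝟘 = 𝟘⁺ ; 𝟙 = ⊤⁺
    ; isLattice = record
      { isEquivalence = isEquivalence
      ; ∨-comm = ⊔⁺-comm ; ∨-assoc = ⊔⁺-assoc ; ∨-cong = cong₂ _⊔⁺_
      ; ∧-comm = ⊓⁺-comm ; ∧-assoc = ⊓⁺-assoc ; ∧-cong = cong₂ _⊓⁺_
      ; absorptive = ⊔⁺-absorbs-⊓⁺ , ⊓⁺-absorbs-⊔⁺ }
    ; isCommutativeMonoid = record
      { isMonoid = record
        { isSemigroup = record
          { isMagma = record { isEquivalence = isEquivalence ; ∙-cong = cong₂ _·⁺_ }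
          ; assoc = ·⁺-assoc }
        ; identity = (λ _ → refl) , ·⁺-identityʳ }
      ; comm = ·⁺-comm }
    ; residuated = residuated⁺
    ; top = ≤⁺-top
    ; bottom = 𝟘⁺-≤⁺
    }

  open FLewProperties A⁺ using () renaming (_^_ to _^⁺_)

  ⟨⟩-^ : ∀ z n k → ⟨ z , fin n ⟩ ^⁺ suc k ≡ ⟨ z ^ suc k , fin (k * suc n + n) ⟩
  ⟨⟩-^ z n zero = cong (λ w → ⟨ w , fin n ⟩) (sym (identityʳ z))
  ⟨⟩-^ z n (suc k) = begin
    ⟨ z , fin n ⟩ ·⁺ ⟨ z , fin n ⟩ ^⁺ suc k
      ≡⟨ cong (⟨ z , fin n ⟩ ·⁺_) (⟨⟩-^ z n k) ⟩
    ⟨ z ^ suc (suc k) , fin (suc (n + (k * suc n + n))) ⟩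
      ≡⟨ cong (λ m → ⟨ z ^ suc (suc k) , fin (suc m) ⟩) (sym (ℕ.+-assoc n (k * suc n) n)) ⟩
    ⟨ z ^ suc (suc k) , fin (suc k * suc n + n) ⟩
      ∎
    where open ≡-Reasoning

  π-⇒⁺ : ∀ a b → π (a ⇒⁺ b) ≡ π a ⇒ π b
  π-⇒⁺ ⊤⁺ b = sym (⇒-identityˡ (π b))
  π-⇒⁺ ⟨ x , d ⟩ ⊤⁺ = sym (⇒-zeroʳ x)
  π-⇒⁺ ⟨ x , d ⟩ ⟨ y , e ⟩ with e ≤∞? d ×-dec (x ⇒ y) ≟ 𝟙
  ... | yes (_ , x⇒y≡𝟙) = sym x⇒y≡𝟙
  ... | no _ = refl

  π-isHom : IsHom A⁺ A π
  π-isHom = record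
    { pres-⊔ = λ { ⊤⁺ b → sym (⊔-zeroˡ (π b)) ; ⟨ x , d ⟩ ⊤⁺ → sym (⊔-zeroʳ x) ; ⟨ x , d ⟩ ⟨ y , e ⟩ → refl }
    ; pres-⊓ = λ { ⊤⁺ b → sym (⊓-identityˡ (π b)) ; ⟨ x , d ⟩ ⊤⁺ → sym (top x) ; ⟨ x , d ⟩ ⟨ y , e ⟩ → refl }
    ; pres-· = λ { ⊤⁺ b → sym (identityˡ (π b)) ; ⟨ x , d ⟩ ⊤⁺ → sym (identityʳ x) ; ⟨ x , d ⟩ ⟨ y , e ⟩ → refl }
    ; pres-⇒ = π-⇒⁺
    ; pres-𝟘 = refl
    ; pres-𝟙 = refl
    }

  π-surjective : Surjective {A⁺} {A} (π , π-isHom)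
  π-surjective x = ⟨ x , fin 0 ⟩ , refl

  module Splitting (finite : Finite A) (section : Hom A A⁺)
                   (splits : ∀ x → x ≡ π (proj₁ section x)) where
    σ : Carrier A → C⁺
    σ = proj₁ section

    σ-hom : IsHom A A⁺ σ
    σ-hom = proj₂ section

    open IsHom σ-hom

    no-finite-depth : ∀ x z n → σ x ≢ ⟨ z , fin n ⟩
    no-finite-depth x z n σx≡⟨z,n⟩ = finite⇒¬ℕ↣ A finite (λ k → x ^ suc k) powers-injective
      where
      σ-power : ∀ k → σ (x ^ suc k) ≡ ⟨ z ^ suc k , fin (k * suc n + n) ⟩
      σ-power k = trans (^-homo σ-hom x (suc k)) (trans (cong (_^⁺ suc k) σx≡⟨z,n⟩) (⟨⟩-^ z n k))

      powers-injective : Injective _≡_ _≡_ (λ k → x ^ suc k)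
      powers-injective {i} {j} xⁱ≡xʲ =
        ℕ.*-cancelʳ-≡ i j (suc n) (ℕ.+-cancelʳ-≡ n _ _ (fin-injective (⟨⟩-injectiveʳ
          (trans (sym (σ-power i)) (trans (cong σ xⁱ≡xʲ) (σ-power j))))))

    σ-below-𝟙 : ∀ x → x ≢ 𝟙 → σ x ≡ ⟨ x , ∞ ⟩
    σ-below-𝟙 x x≢𝟙 with σ x in σx≡
    ... | ⊤⁺ = ⊥-elim (x≢𝟙 (trans (splits x) (cong π σx≡)))
    ... | ⟨ z , fin n ⟩ = ⊥-elim (no-finite-depth x z n σx≡)
    ... | ⟨ z , ∞ ⟩ = cong (λ w → ⟨ w , ∞ ⟩) (sym (trans (splits x) (cong π σx≡)))

    complement-≡𝟙 : ∀ x → x ≢ 𝟙 → x ⇒ 𝟘 ≡ 𝟙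
    complement-≡𝟙 x x≢𝟙 with ⇒⁺-componentwise x 𝟘 ∞ ∞
    ... | inj₁ x⇒𝟘≡𝟙 = x⇒𝟘≡𝟙
    ... | inj₂ residual = ⊥-elim (no-finite-depth (x ⇒ 𝟘) (x ⇒ 𝟘) 0 (begin
      σ (x ⇒ 𝟘)                 ≡⟨ pres-⇒ x 𝟘 ⟩
      σ x ⇒⁺ σ 𝟘                ≡⟨ cong₂ _⇒⁺_ (σ-below-𝟙 x x≢𝟙) pres-𝟘 ⟩
      ⟨ x , ∞ ⟩ ⇒⁺ ⟨ 𝟘 , ∞ ⟩    ≡⟨ residual ⟩
      ⟨ x ⇒ 𝟘 , fin 0 ⟩         ∎))
      where open ≡-Reasoning

    two-valued : ∀ x → x ≡ 𝟘 ⊎ x ≡ 𝟙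
    two-valued x with x ≟ 𝟙
    ... | yes x≡𝟙 = inj₂ x≡𝟙
    ... | no x≢𝟙 = inj₁ (⇒𝟘≡𝟙→≡𝟘 (complement-≡𝟙 x x≢𝟙))

    𝟘≢𝟙 : 𝟘 ≢ 𝟙
    𝟘≢𝟙 𝟘≡𝟙 with trans (sym pres-𝟘) (trans (cong σ 𝟘≡𝟙) pres-𝟙)
    ... | ()

finite-projective⇒≅𝟚 : (A : FLew) → Finite A → Projective A → A ≅ 𝟚
finite-projective⇒≅𝟚 A finite projective = two-valued⇒≅𝟚 A 𝟘≢𝟙 two-valued
  where
  open Cover A (finite⇒decidableEquality A finite)
  π-splits : Σ (Hom A A⁺) (λ σ → ∀ x → x ≡ π (proj₁ σ x))
  π-splits = projective A⁺ A (id , id-isHom A) (π , π-isHom) π-surjective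
  open Splitting finite (proj₁ π-splits) (proj₂ π-splits)

mainTheorem1 : Projective 𝟚 × ((A : FLew) → Finite A → Projective A → A ≅ 𝟚)
mainTheorem1 = 𝟚-projective , finite-projective⇒≅𝟚
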